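{- Let $\Lambda_3$ be the lattice with basis $e_1,e_2,e_3$ and Gram matrix $2\begin{pmatrix}2&-1&0\\-1&2&-1\\0&-1&2\end{pmatrix}$. Every integral lattice $M$ in $\mathbb{R}\Lambda_3$ with $\Lambda_3\subseteq M$ is isometric to one of the four lattices $\Lambda_3$, $\Lambda_3(\tfrac12 e_1)$, $\Lambda_3(\tfrac12(e_1+e_3))$, $\Lambda_3(\tfrac12 e_1,\tfrac12 e_3)$.
   Context: A lattice is integral if all inner products of its vectors are integers. For a lattice $L$ and vectors $x_1,\dots,x_k$ in $\mathbb{R}L$, $L(x_1,\dots,x_k)$ denotes the lattice $\langle L,x_1,\dots,x_k\rangle$ generated by $L$ and the $x_i$.
   Formalization: The lattices M consist of vectors with rational coordinates in the basis $e_1,e_2,e_3$ rather than arbitrary points of $\mathbb{R}\Lambda_3$, and the isometry is taken with rational coefficients in that basis. -}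

module Defs where

open import Data.Nat using (ℕ; zero; suc)
open import Data.Integer using (ℤ; +_; -[1+_])
open import Data.Fin using (Fin; zero; suc)
open import Data.Rational using (ℚ; _+_; _*_; _/_; 0ℚ; ½)
open import Data.Product using (Σ; _×_; _,_)
open import Data.Sum using (_⊎_)
open import Relation.Binary.PropositionalEquality using (_≡_)

-- Vectors of ℝΛ₃ are given by their (rational) coordinates w.r.t. the basis e₁,e₂,e₃.
V : Set
V = Fin 3 → ℚ

ι : ℤ → ℚ
ι z = z / 1

IsInt : ℚ → Set
IsInt q = Σ ℤ λ z → q ≡ ι z

sumF : ∀ {k} → (Fin k → ℚ) → ℚ
sumF {zero} f = 0ℚ
sumF {suc k} f = f zero + sumF (λ i → f (suc i))

G : Fin 3 → Fin 3 → ℚ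
G zero zero = ι (+ 4)
G zero (suc zero) = ι (-[1+ 1 ])
G zero (suc (suc zero)) = ι (+ 0)
G (suc zero) zero = ι (-[1+ 1 ])
G (suc zero) (suc zero) = ι (+ 4)
G (suc zero) (suc (suc zero)) = ι (-[1+ 1 ])
G (suc (suc zero)) zero = ι (+ 0)
G (suc (suc zero)) (suc zero) = ι (-[1+ 1 ])
G (suc (suc zero)) (suc (suc zero)) = ι (+ 4)

⟪_,_⟫ : V → V → ℚ
⟪ x , y ⟫ = sumF λ i → sumF λ j → x i * (G i j * y j)

_≈_ : V → V → Set
x ≈ y = ∀ i → x i ≡ y i

e : Fin 3 → V
e zero zero = ι (+ 1)
e (suc zero) (suc zero) = ι (+ 1)
e (suc (suc zero)) (suc (suc zero)) = ι (+ 1)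
e _ _ = 0ℚ

_∈⟨_⟩ : ∀ {k} → V → (Fin k → V) → Set
_∈⟨_⟩ {k} x g = Σ (Fin k → ℤ) λ c → x ≈ (λ i → sumF λ l → ι (c l) * g l i)

Integral : ∀ {k} → (Fin k → V) → Set
Integral g = ∀ x y → x ∈⟨ g ⟩ → y ∈⟨ g ⟩ → IsInt ⟪ x , y ⟫

apply : (Fin 3 → Fin 3 → ℚ) → V → V
apply A x i = sumF λ j → A i j * x j

Isometric : ∀ {k m} → (Fin k → V) → (Fin m → V) → Set
Isometric g h = Σ (Fin 3 → Fin 3 → ℚ) λ A →
  (∀ x y → ⟪ apply A x , apply A y ⟫ ≡ ⟪ x , y ⟫)
  × (∀ x → x ∈⟨ g ⟩ → apply A x ∈⟨ h ⟩)
  × (∀ y → y ∈⟨ h ⟩ → Σ V λ x → x ∈⟨ g ⟩ × (apply A x ≈ y))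

scale : ℚ → V → V
scale q x i = q * x i

addV : V → V → V
addV x y i = x i + y i

e₁ e₂ e₃ : V
e₁ = e zero
e₂ = e (suc zero)
e₃ = e (suc (suc zero))

Λ₃ : Fin 3 → V
Λ₃ = e

Λa : Fin 4 → V
Λa zero = scale ½ e₁
Λa (suc j) = e j

Λb : Fin 4 → V
Λb zero = scale ½ (addV e₁ e₃)
Λb (suc j) = e j

Λc : Fin 5 → V
Λc zero = scale ½ e₁
Λc (suc zero) = scale ½ e₃
Λc (suc (suc j)) = e j

-- The integrality of ⟪x,e_j⟫ and ⟪x,x⟫ forces every x ∈ M into ½Λ₃: with a = Gx ∈ ℤ³ one has
-- 8x = (8G⁻¹)a and 8⟪x,x⟫ = aᵀ(8G⁻¹)a, and a residue computation modulo 8 shows 4 ∣ (8G⁻¹)a.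
-- So M is determined by its image in ½Λ₃/Λ₃ ≅ 𝔽₂³, a subgroup on which the form 2⟪x,y⟫ mod 2
-- vanishes. Enumerating all subsets of 𝔽₂³ shows that every such isotropic subgroup is carried
-- by one of six involutive automorphisms of Λ₃ onto the image of one of the four listed lattices.

module Submission where

open import Defs
open import Level using (0ℓ)
open import Function using (_∘_; id)
open import Data.Bool using (Bool; true; false; T; not; _∧_; _∨_; _xor_)
open import Data.Bool.Properties using (xor-comm; xor-assoc; xor-same; xor-identityʳ; T-∨; T-∧)
open import Function.Bundles using (Equivalence)
open import Data.Empty using (⊥; ⊥-elim)
open import Data.Fin using (Fin; zero; suc; toℕ; fromℕ<; splitAt)
open import Data.Fin.Patterns using (0F; 1F; 2F; 3F; 4F; 5F; 6F; 7F)
open import Data.Fin.Properties using (all?; toℕ-fromℕ<)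
open import Data.Integer as ℤ using (ℤ; +_; -[1+_]; 0ℤ; 1ℤ; -1ℤ)
import Data.Integer.Properties as ℤP
import Data.Integer.DivMod as ℤDM
open import Data.Integer.Divisibility.Signed
  using (_∣_; _∣?_; divides; ∣-refl; ∣m⇒∣m*n; ∣m∣n⇒∣m+n; ∣m+n∣n⇒∣m)
open import Data.Integer.Tactic.RingSolver using () renaming (solve-∀ to solveℤ)
open import Data.Maybe using (Maybe; just; nothing)
open import Data.Nat as ℕ using (ℕ)
import Data.Nat.Coprimality as Coprime
open import Data.Product using (Σ; ∃; _×_; _,_; proj₁; proj₂)
open import Data.Sum as Sum using (_⊎_; inj₁; inj₂)
open import Data.Rational as ℚ using (ℚ; mkℚ; 0ℚ; ½; ↥_)
import Data.Rational.Properties as ℚP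
open import Data.Unit using (tt)
open import Data.Vec.Functional using (_++_; _∷_; [])
open import Data.Vec as Vec using (Vec)
open import Data.List as List using (List)
open import Data.Bool.ListAction using (any)
import Data.List.Relation.Unary.Any as Any
open import Data.List.Relation.Unary.Any.Properties using (any⁻)
open import Algebra.Bundles using (CommutativeRing)
import Algebra.Properties.Semiring.Sum as SemiringSum
open import Relation.Nullary using (yes; no)
open import Relation.Nullary.Decidable using (True; toWitness; toWitnessFalse; _→-dec_)
open import Relation.Binary.PropositionalEquality
open ≡-Reasoning
import Tactic.RingSolver.Core.AlmostCommutativeRing as ACR
open import Tactic.RingSolver using () renaming (solve-∀ to solveℚ)

ℚ-ring : ACR.AlmostCommutativeRing 0ℓ 0ℓ
ℚ-ring = ACR.fromCommutativeRing ℚP.+-*-commutativeRing isZero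
  where
  isZero : ∀ x → Maybe (0ℚ ≡ x)
  isZero x with 0ℚ ℚP.≟ x
  ... | yes p = just p
  ... | no _ = nothing

ι≡mkℚ : ∀ z → ι z ≡ mkℚ z 0 (Coprime.sym (Coprime.1-coprimeTo _))
ι≡mkℚ z = ℚP.↥p/↧p≡p _

ι-+ : ∀ a b → ι (a ℤ.+ b) ≡ ι a ℚ.+ ι b
ι-+ a b = begin
  ι (a ℤ.+ b)                       ≡⟨ cong₂ (λ u v → ι (u ℤ.+ v)) (sym (ℤP.*-identityʳ a)) (sym (ℤP.*-identityʳ b)) ⟩
  ι (a ℤ.* 1ℤ ℤ.+ b ℤ.* 1ℤ)         ≡⟨ sym (cong₂ ℚ._+_ (ι≡mkℚ a) (ι≡mkℚ b)) ⟩
  ι a ℚ.+ ι b                       ∎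

ι-* : ∀ a b → ι (a ℤ.* b) ≡ ι a ℚ.* ι b
ι-* a b = sym (cong₂ ℚ._*_ (ι≡mkℚ a) (ι≡mkℚ b))

ι-injective : ∀ {a b} → ι a ≡ ι b → a ≡ b
ι-injective {a} {b} eq = cong ↥_ (trans (sym (ι≡mkℚ a)) (trans eq (ι≡mkℚ b)))

fromBit : Bool → ℤ
fromBit false = 0ℤ
fromBit true = 1ℤ

record _hasParity_ (z : ℤ) (b : Bool) : Set where
  constructor parityWitness
  field
    half : ℤ
    decomposition : z ≡ fromBit b ℤ.+ + 2 ℤ.* half

fromBit-+ : ∀ b c → fromBit b ℤ.+ fromBit c ≡ fromBit (b xor c) ℤ.+ + 2 ℤ.* fromBit (b ∧ c)
fromBit-+ false false = refl
fromBit-+ false true = refl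
fromBit-+ true false = refl
fromBit-+ true true = refl

fromBit-* : ∀ b c → fromBit b ℤ.* fromBit c ≡ fromBit (b ∧ c)
fromBit-* false c = refl
fromBit-* true false = refl
fromBit-* true true = refl

hasParity-+ : ∀ {x y b c} → x hasParity b → y hasParity c → (x ℤ.+ y) hasParity (b xor c)
hasParity-+ {b = b} {c} (parityWitness q refl) (parityWitness r refl) =
  parityWitness (fromBit (b ∧ c) ℤ.+ (q ℤ.+ r)) (begin
    B ℤ.+ + 2 ℤ.* q ℤ.+ (C ℤ.+ + 2 ℤ.* r)  ≡⟨ regroup B C q r ⟩
    B ℤ.+ C ℤ.+ + 2 ℤ.* (q ℤ.+ r)          ≡⟨ cong (ℤ._+ + 2 ℤ.* (q ℤ.+ r)) (fromBit-+ b c) ⟩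
    D ℤ.+ + 2 ℤ.* E ℤ.+ + 2 ℤ.* (q ℤ.+ r)  ≡⟨ collect D E (q ℤ.+ r) ⟩
    D ℤ.+ + 2 ℤ.* (E ℤ.+ (q ℤ.+ r))        ∎)
  where
  B = fromBit b
  C = fromBit c
  D = fromBit (b xor c)
  E = fromBit (b ∧ c)
  regroup : ∀ B C q r → B ℤ.+ + 2 ℤ.* q ℤ.+ (C ℤ.+ + 2 ℤ.* r) ≡ B ℤ.+ C ℤ.+ + 2 ℤ.* (q ℤ.+ r)
  regroup = solveℤ
  collect : ∀ D E s → D ℤ.+ + 2 ℤ.* E ℤ.+ + 2 ℤ.* s ≡ D ℤ.+ + 2 ℤ.* (E ℤ.+ s)
  collect = solveℤ

hasParity-* : ∀ {x y b c} → x hasParity b → y hasParity c → (x ℤ.* y) hasParity (b ∧ c)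
hasParity-* {b = b} {c} (parityWitness q refl) (parityWitness r refl) =
  parityWitness s (begin
    (B ℤ.+ + 2 ℤ.* q) ℤ.* (C ℤ.+ + 2 ℤ.* r)  ≡⟨ expand B C q r ⟩
    B ℤ.* C ℤ.+ + 2 ℤ.* s                    ≡⟨ cong (λ w → w ℤ.+ + 2 ℤ.* s) (fromBit-* b c) ⟩
    fromBit (b ∧ c) ℤ.+ + 2 ℤ.* s            ∎)
  where
  B = fromBit b
  C = fromBit c
  s = B ℤ.* r ℤ.+ q ℤ.* C ℤ.+ + 2 ℤ.* q ℤ.* r
  expand : ∀ B C q r → (B ℤ.+ + 2 ℤ.* q) ℤ.* (C ℤ.+ + 2 ℤ.* r) ≡ B ℤ.* C ℤ.+ + 2 ℤ.* (B ℤ.* r ℤ.+ q ℤ.* C ℤ.+ + 2 ℤ.* q ℤ.* r)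
  expand = solveℤ

parity-decomposition : ∀ z → ∃ λ b → z hasParity b
parity-decomposition z with z ℤDM.% + 2 | ℤDM.n%d<d z (+ 2) | ℤDM.a≡a%n+[a/n]*n z (+ 2)
... | 0 | _ | eq = false , parityWitness (z ℤDM./ + 2) (trans eq (cong (λ w → 0ℤ ℤ.+ w) (ℤP.*-comm (z ℤDM./ + 2) (+ 2))))
... | 1 | _ | eq = true , parityWitness (z ℤDM./ + 2) (trans eq (cong (λ w → 1ℤ ℤ.+ w) (ℤP.*-comm (z ℤDM./ + 2) (+ 2))))
... | ℕ.suc (ℕ.suc _) | ℕ.s≤s (ℕ.s≤s ()) | _

parity : ℤ → Bool
parity z = proj₁ (parity-decomposition z)

hasParity-parity : ∀ z → z hasParity parity z
hasParity-parity z = proj₂ (parity-decomposition z)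

even≢odd : ∀ {z} → z hasParity false → z hasParity true → ⊥
even≢odd (parityWitness q refl) (parityWitness r even≡odd) = 2∤1 (divides (q ℤ.- r) (begin
  1ℤ                                   ≡⟨ solve₁ r ⟩
  1ℤ ℤ.+ + 2 ℤ.* r ℤ.- + 2 ℤ.* r       ≡⟨ cong (ℤ._- + 2 ℤ.* r) even≡odd ⟨
  0ℤ ℤ.+ + 2 ℤ.* q ℤ.- + 2 ℤ.* r       ≡⟨ solve₂ q r ⟩
  (q ℤ.- r) ℤ.* + 2                    ∎))
  where
  2∤1 = toWitnessFalse {a? = + 2 ∣? 1ℤ} tt
  solve₁ : ∀ r → 1ℤ ≡ 1ℤ ℤ.+ + 2 ℤ.* r ℤ.- + 2 ℤ.* r
  solve₁ = solveℤ
  solve₂ : ∀ q r → 0ℤ ℤ.+ + 2 ℤ.* q ℤ.- + 2 ℤ.* r ≡ (q ℤ.- r) ℤ.* + 2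
  solve₂ = solveℤ

hasParity-unique : ∀ {z b c} → z hasParity b → z hasParity c → b ≡ c
hasParity-unique {b = false} {false} _ _ = refl
hasParity-unique {b = true} {true} _ _ = refl
hasParity-unique {b = false} {true} p q = ⊥-elim (even≢odd p q)
hasParity-unique {b = true} {false} p q = ⊥-elim (even≢odd q p)

-- Polynomials with integer coefficients, evaluated over ℤ, ℚ and 𝔽₂ = Bool

infixl 6 _:+_
infixl 7 _:*_

data Poly (n : ℕ) : Set where
  var : Fin n → Poly n
  con : ℤ → Poly n
  _:+_ _:*_ : Poly n → Poly n → Poly n

eval : {A : Set} → (A → A → A) → (A → A → A) → (ℤ → A) → ∀ {n} → Poly n → (Fin n → A) → A
eval _+_ _*_ κ (var i) ρ = ρ i
eval _+_ _*_ κ (con c) ρ = κ c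
eval _+_ _*_ κ (p :+ q) ρ = eval _+_ _*_ κ p ρ + eval _+_ _*_ κ q ρ
eval _+_ _*_ κ (p :* q) ρ = eval _+_ _*_ κ p ρ * eval _+_ _*_ κ q ρ

⟦_⟧ℤ : ∀ {n} → Poly n → (Fin n → ℤ) → ℤ
⟦_⟧ℤ = eval ℤ._+_ ℤ._*_ id

⟦_⟧ℚ : ∀ {n} → Poly n → (Fin n → ℚ) → ℚ
⟦_⟧ℚ = eval ℚ._+_ ℚ._*_ ι

⟦_⟧₂ : ∀ {n} → Poly n → (Fin n → Bool) → Bool
⟦_⟧₂ = eval _xor_ _∧_ parity

ι-⟦⟧ : ∀ {n} (p : Poly n) ρ → ι (⟦ p ⟧ℤ ρ) ≡ ⟦ p ⟧ℚ (ι ∘ ρ)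
ι-⟦⟧ (var i) ρ = refl
ι-⟦⟧ (con c) ρ = refl
ι-⟦⟧ (p :+ q) ρ = trans (ι-+ (⟦ p ⟧ℤ ρ) (⟦ q ⟧ℤ ρ)) (cong₂ ℚ._+_ (ι-⟦⟧ p ρ) (ι-⟦⟧ q ρ))
ι-⟦⟧ (p :* q) ρ = trans (ι-* (⟦ p ⟧ℤ ρ) (⟦ q ⟧ℤ ρ)) (cong₂ ℚ._*_ (ι-⟦⟧ p ρ) (ι-⟦⟧ q ρ))

⟦⟧ℚ-cong : ∀ {n} (p : Poly n) {ρ σ : Fin n → ℚ} → (∀ i → ρ i ≡ σ i) → ⟦ p ⟧ℚ ρ ≡ ⟦ p ⟧ℚ σ
⟦⟧ℚ-cong (var i) ρ≡σ = ρ≡σ i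
⟦⟧ℚ-cong (con c) ρ≡σ = refl
⟦⟧ℚ-cong (p :+ q) ρ≡σ = cong₂ ℚ._+_ (⟦⟧ℚ-cong p ρ≡σ) (⟦⟧ℚ-cong q ρ≡σ)
⟦⟧ℚ-cong (p :* q) ρ≡σ = cong₂ ℚ._*_ (⟦⟧ℚ-cong p ρ≡σ) (⟦⟧ℚ-cong q ρ≡σ)

⟦⟧ℤ-congruent : ∀ {n} m (p : Poly n) {α β w : Fin n → ℤ} →
  (∀ i → α i ≡ β i ℤ.+ m ℤ.* w i) → ∃ λ c → ⟦ p ⟧ℤ α ≡ ⟦ p ⟧ℤ β ℤ.+ m ℤ.* c
⟦⟧ℤ-congruent m (var i) {w = w} α≡β = w i , α≡β i
⟦⟧ℤ-congruent m (con c) α≡β = 0ℤ , solve-con m c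
  where
  solve-con : ∀ m c → c ≡ c ℤ.+ m ℤ.* 0ℤ
  solve-con = solveℤ
⟦⟧ℤ-congruent m (p :+ q) {α} {β} {w} α≡β with ⟦⟧ℤ-congruent m p {α} {β} {w} α≡β | ⟦⟧ℤ-congruent m q {α} {β} {w} α≡β
... | c , p≡ | d , q≡ = c ℤ.+ d , trans (cong₂ ℤ._+_ p≡ q≡) (solve-+ (⟦ p ⟧ℤ β) (⟦ q ⟧ℤ β) m c d)
  where
  solve-+ : ∀ a b m c d → a ℤ.+ m ℤ.* c ℤ.+ (b ℤ.+ m ℤ.* d) ≡ a ℤ.+ b ℤ.+ m ℤ.* (c ℤ.+ d)
  solve-+ = solveℤ
⟦⟧ℤ-congruent m (p :* q) {α} {β} {w} α≡β with ⟦⟧ℤ-congruent m p {α} {β} {w} α≡β | ⟦⟧ℤ-congruent m q {α} {β} {w} α≡β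
... | c , p≡ | d , q≡ = _ , trans (cong₂ ℤ._*_ p≡ q≡) (solve-* (⟦ p ⟧ℤ β) (⟦ q ⟧ℤ β) m c d)
  where
  solve-* : ∀ a b m c d → (a ℤ.+ m ℤ.* c) ℤ.* (b ℤ.+ m ℤ.* d) ≡ a ℤ.* b ℤ.+ m ℤ.* (a ℤ.* d ℤ.+ c ℤ.* b ℤ.+ m ℤ.* c ℤ.* d)
  solve-* = solveℤ

hasParity-⟦⟧ : ∀ {n} (p : Poly n) {α : Fin n → ℤ} {b} → (∀ i → α i hasParity b i) → ⟦ p ⟧ℤ α hasParity ⟦ p ⟧₂ b
hasParity-⟦⟧ (var i) α≡b = α≡b i
hasParity-⟦⟧ (con c) α≡b = hasParity-parity c
hasParity-⟦⟧ (p :+ q) {α} α≡b = hasParity-+ (hasParity-⟦⟧ p {α} α≡b) (hasParity-⟦⟧ q {α} α≡b)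
hasParity-⟦⟧ (p :* q) {α} α≡b = hasParity-* (hasParity-⟦⟧ p {α} α≡b) (hasParity-⟦⟧ q {α} α≡b)

hasParity-++ : ∀ {m n} {α : Fin m → ℤ} {β : Fin n → ℤ} {b c} →
  (∀ i → α i hasParity b i) → (∀ i → β i hasParity c i) → ∀ j → (α ++ β) j hasParity (b ++ c) j
hasParity-++ {m} α≡b β≡c j with splitAt m j
... | inj₁ i = α≡b i
... | inj₂ i = β≡c i

module Σℚ = SemiringSum (CommutativeRing.semiring ℚP.+-*-commutativeRing)
open Σℚ using (sum; sum-cong-≗; ∑-distrib-+; *-distribˡ-sum; ∑-comm)

sumF≡sum : ∀ {k} (f : Fin k → ℚ) → sumF f ≡ sum f
sumF≡sum {ℕ.zero} f = refl
sumF≡sum {ℕ.suc k} f = cong (f zero ℚ.+_) (sumF≡sum (f ∘ suc))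

sumF-0 : ∀ {k} (f : Fin k → ℚ) → sumF (λ l → ι 0ℤ ℚ.* f l) ≡ 0ℚ
sumF-0 {k} f = begin
  sumF (λ l → ι 0ℤ ℚ.* f l)  ≡⟨ sumF≡sum (λ l → ι 0ℤ ℚ.* f l) ⟩
  sum (λ l → ι 0ℤ ℚ.* f l)   ≡⟨ sum-cong-≗ (λ l → ℚP.*-zeroˡ (f l)) ⟩
  sum {k} (λ _ → 0ℚ)         ≡⟨ Σℚ.sum-replicate-zero k ⟩
  0ℚ                         ∎

module _ {k} {g : Fin k → V} where

  ∈⟨⟩-cong : ∀ {x y} → x ≈ y → y ∈⟨ g ⟩ → x ∈⟨ g ⟩
  ∈⟨⟩-cong x≈y (c , y≈) = c , λ i → trans (x≈y i) (y≈ i)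

  ∈⟨⟩-0 : (λ _ → 0ℚ) ∈⟨ g ⟩
  ∈⟨⟩-0 = (λ _ → 0ℤ) , λ i → sym (sumF-0 (λ l → g l i))

  ∈⟨⟩-+ : ∀ {x y} → x ∈⟨ g ⟩ → y ∈⟨ g ⟩ → addV x y ∈⟨ g ⟩
  ∈⟨⟩-+ {x} {y} (c , x≈) (d , y≈) = (λ l → c l ℤ.+ d l) , λ i → begin
    x i ℚ.+ y i                                          ≡⟨ cong₂ ℚ._+_ (x≈ i) (y≈ i) ⟩
    sumF (λ l → ι (c l) ℚ.* g l i) ℚ.+ sumF (λ l → ι (d l) ℚ.* g l i)
                                                         ≡⟨ cong₂ ℚ._+_ (sumF≡sum (λ l → ι (c l) ℚ.* g l i)) (sumF≡sum (λ l → ι (d l) ℚ.* g l i)) ⟩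
    sum (λ l → ι (c l) ℚ.* g l i) ℚ.+ sum (λ l → ι (d l) ℚ.* g l i)
                                                         ≡⟨ ∑-distrib-+ (λ l → ι (c l) ℚ.* g l i) (λ l → ι (d l) ℚ.* g l i) ⟨
    sum (λ l → ι (c l) ℚ.* g l i ℚ.+ ι (d l) ℚ.* g l i)  ≡⟨ sum-cong-≗ (λ l → distrib (c l) (d l) (g l i)) ⟨
    sum (λ l → ι (c l ℤ.+ d l) ℚ.* g l i)                ≡⟨ sumF≡sum (λ l → ι (c l ℤ.+ d l) ℚ.* g l i) ⟨
    sumF (λ l → ι (c l ℤ.+ d l) ℚ.* g l i)               ∎
    where
    distrib : ∀ a b u → ι (a ℤ.+ b) ℚ.* u ≡ ι a ℚ.* u ℚ.+ ι b ℚ.* u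
    distrib a b u = trans (cong (ℚ._* u) (ι-+ a b)) (ℚP.*-distribʳ-+ u (ι a) (ι b))

  ∈⟨⟩-scale : ∀ {x} (z : ℤ) → x ∈⟨ g ⟩ → scale (ι z) x ∈⟨ g ⟩
  ∈⟨⟩-scale {x} z (c , x≈) = (λ l → z ℤ.* c l) , λ i → begin
    ι z ℚ.* x i                                 ≡⟨ cong (ι z ℚ.*_) (trans (x≈ i) (sumF≡sum (λ l → ι (c l) ℚ.* g l i))) ⟩
    ι z ℚ.* sum (λ l → ι (c l) ℚ.* g l i)       ≡⟨ *-distribˡ-sum (ι z) (λ l → ι (c l) ℚ.* g l i) ⟩
    sum (λ l → ι z ℚ.* (ι (c l) ℚ.* g l i))     ≡⟨ sum-cong-≗ (λ l → assoc (c l) (g l i)) ⟩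
    sum (λ l → ι (z ℤ.* c l) ℚ.* g l i)         ≡⟨ sumF≡sum (λ l → ι (z ℤ.* c l) ℚ.* g l i) ⟨
    sumF (λ l → ι (z ℤ.* c l) ℚ.* g l i)        ∎
    where
    assoc : ∀ a u → ι z ℚ.* (ι a ℚ.* u) ≡ ι (z ℤ.* a) ℚ.* u
    assoc a u = trans (sym (ℚP.*-assoc (ι z) (ι a) u)) (cong (ℚ._* u) (sym (ι-* z a)))

∈⟨⟩-tail : ∀ {k} {g : Fin (ℕ.suc k) → V} {x} → x ∈⟨ g ∘ suc ⟩ → x ∈⟨ g ⟩
∈⟨⟩-tail {g = g} (c , x≈) = (0ℤ ∷ c) , λ i →
  trans (x≈ i) (sym (trans (cong (ℚ._+ sumF (λ l → ι (c l) ℚ.* g (suc l) i)) (ℚP.*-zeroˡ (g zero i))) (ℚP.+-identityˡ _)))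

∈⟨⟩-generator : ∀ {k} (g : Fin k → V) l → g l ∈⟨ g ⟩
∈⟨⟩-generator g zero = (1ℤ ∷ λ _ → 0ℤ) , λ i →
  sym (trans (cong₂ ℚ._+_ (ℚP.*-identityˡ (g zero i)) (sumF-0 (λ l → g (suc l) i))) (ℚP.+-identityʳ (g zero i)))
∈⟨⟩-generator g (suc l) = ∈⟨⟩-tail {g = g} (∈⟨⟩-generator (g ∘ suc) l)

-- Classes modulo Λ₃ of vectors of ½Λ₃, i.e. the group ½Λ₃/Λ₃ ≅ 𝔽₂³

Class : Set
Class = Bool × Bool × Bool

bits : Class → Fin 3 → Bool
bits (a , b , c) 0F = a
bits (a , b , c) 1F = b
bits (a , b , c) 2F = c

classOf : (Fin 3 → Bool) → Class
classOf f = f 0F , f 1F , f 2F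

0ᶜ : Class
0ᶜ = false , false , false

isZeroᶜ : Class → Bool
isZeroᶜ (a , b , c) = not (a ∨ b ∨ c)

isZeroᶜ-sound : ∀ c → T (isZeroᶜ c) → c ≡ 0ᶜ
isZeroᶜ-sound (false , false , false) _ = refl

infixl 6 _⊕_
_⊕_ : Class → Class → Class
(a , b , c) ⊕ (a′ , b′ , c′) = a xor a′ , b xor b′ , c xor c′

_·ᶜ_ : Bool → Class → Class
false ·ᶜ c = 0ᶜ
true ·ᶜ c = c

bits-classOf : ∀ f i → bits (classOf f) i ≡ f i
bits-classOf f 0F = refl
bits-classOf f 1F = refl
bits-classOf f 2F = refl

bits-0ᶜ : ∀ i → bits 0ᶜ i ≡ false
bits-0ᶜ 0F = refl
bits-0ᶜ 1F = refl
bits-0ᶜ 2F = refl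

bits-⊕ : ∀ c d i → bits (c ⊕ d) i ≡ bits c i xor bits d i
bits-⊕ (a , b , c) (a′ , b′ , c′) 0F = refl
bits-⊕ (a , b , c) (a′ , b′ , c′) 1F = refl
bits-⊕ (a , b , c) (a′ , b′ , c′) 2F = refl

bits-·ᶜ : ∀ p c i → bits (p ·ᶜ c) i ≡ p ∧ bits c i
bits-·ᶜ false c i = bits-0ᶜ i
bits-·ᶜ true c i = refl

⊕-assoc : ∀ c d f → c ⊕ d ⊕ f ≡ c ⊕ (d ⊕ f)
⊕-assoc (a , b , c) (a′ , b′ , c′) (a″ , b″ , c″) =
  cong₂ _,_ (xor-assoc a a′ a″) (cong₂ _,_ (xor-assoc b b′ b″) (xor-assoc c c′ c″))

⊕-comm : ∀ c d → c ⊕ d ≡ d ⊕ c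
⊕-comm (a , b , c) (a′ , b′ , c′) = cong₂ _,_ (xor-comm a a′) (cong₂ _,_ (xor-comm b b′) (xor-comm c c′))

⊕-self : ∀ c → c ⊕ c ≡ 0ᶜ
⊕-self (a , b , c) = cong₂ _,_ (xor-same a) (cong₂ _,_ (xor-same b) (xor-same c))

⊕-identityʳ : ∀ c → c ⊕ 0ᶜ ≡ c
⊕-identityʳ (a , b , c) = cong₂ _,_ (xor-identityʳ a) (cong₂ _,_ (xor-identityʳ b) (xor-identityʳ c))

⊕-cancelʳ : ∀ c d → c ⊕ d ⊕ d ≡ c
⊕-cancelʳ c d = trans (⊕-assoc c d d) (trans (cong (c ⊕_) (⊕-self d)) (⊕-identityʳ c))

⊕-swapʳ : ∀ c d f → c ⊕ d ⊕ f ≡ c ⊕ f ⊕ d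
⊕-swapʳ c d f = trans (⊕-assoc c d f) (trans (cong (c ⊕_) (⊕-comm d f)) (sym (⊕-assoc c f d)))

HalfInt : Class → V → Set
HalfInt c x = Σ (Fin 3 → ℤ) λ n → (∀ i → x i ≡ ½ ℚ.* ι (n i)) × (∀ i → n i hasParity bits c i)

HalfInt-cong : ∀ {c x y} → x ≈ y → HalfInt c y → HalfInt c x
HalfInt-cong x≈y (n , y≡ , par) = n , (λ i → trans (x≈y i) (y≡ i)) , par

HalfInt-0 : HalfInt 0ᶜ (λ _ → 0ℚ)
HalfInt-0 = (λ _ → 0ℤ) , (λ i → refl) , λ { 0F → even ; 1F → even ; 2F → even }
  where
  even : 0ℤ hasParity false
  even = parityWitness 0ℤ refl

HalfInt-+ : ∀ {c d x y} → HalfInt c x → HalfInt d y → HalfInt (c ⊕ d) (addV x y)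
HalfInt-+ {c} {d} (n , x≡ , n-par) (m , y≡ , m-par) =
  (λ i → n i ℤ.+ m i) ,
  (λ i → trans (cong₂ ℚ._+_ (x≡ i) (y≡ i)) (half-+ (n i) (m i))) ,
  (λ i → subst (_ hasParity_) (sym (bits-⊕ c d i)) (hasParity-+ (n-par i) (m-par i)))
  where
  half-+ : ∀ a b → ½ ℚ.* ι a ℚ.+ ½ ℚ.* ι b ≡ ½ ℚ.* ι (a ℤ.+ b)
  half-+ a b = trans (sym (ℚP.*-distribˡ-+ ½ (ι a) (ι b))) (cong (½ ℚ.*_) (sym (ι-+ a b)))

HalfInt-scale : ∀ {c x} z → HalfInt c x → HalfInt (parity z ·ᶜ c) (scale (ι z) x)
HalfInt-scale {c} z (n , x≡ , n-par) =
  (λ i → z ℤ.* n i) ,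
  (λ i → trans (cong (ι z ℚ.*_) (x≡ i)) (half-* (n i))) ,
  (λ i → subst (_ hasParity_) (sym (bits-·ᶜ (parity z) c i)) (hasParity-* (hasParity-parity z) (n-par i)))
  where
  half-* : ∀ a → ι z ℚ.* (½ ℚ.* ι a) ≡ ½ ℚ.* ι (z ℤ.* a)
  half-* a = trans (solve (ι z) (ι a)) (cong (½ ℚ.*_) (sym (ι-* z a)))
    where
    solve : ∀ u w → u ℚ.* (½ ℚ.* w) ≡ ½ ℚ.* (u ℚ.* w)
    solve = solveℚ ℚ-ring

HalfInt-0ᶜ⇒∈⟨⟩ : ∀ {k} {g : Fin k → V} → (∀ j → e j ∈⟨ g ⟩) → ∀ {y} → HalfInt 0ᶜ y → y ∈⟨ g ⟩
HalfInt-0ᶜ⇒∈⟨⟩ e∈ {y} (n , y≡ , n-par) =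
  ∈⟨⟩-cong coordinates (∈⟨⟩-+ (∈⟨⟩-scale (q 0F) (e∈ 0F)) (∈⟨⟩-+ (∈⟨⟩-scale (q 1F) (e∈ 1F)) (∈⟨⟩-scale (q 2F) (e∈ 2F))))
  where
  q : Fin 3 → ℤ
  q i = _hasParity_.half (n-par i)
  y≡q : ∀ i → y i ≡ ι (q i)
  y≡q i = begin
    y i                               ≡⟨ y≡ i ⟩
    ½ ℚ.* ι (n i)                     ≡⟨ cong (λ m → ½ ℚ.* ι m) (trans (_hasParity_.decomposition (n-par i)) (cong (λ b → fromBit b ℤ.+ + 2 ℤ.* q i) (bits-0ᶜ i))) ⟩
    ½ ℚ.* ι (0ℤ ℤ.+ + 2 ℤ.* q i)      ≡⟨ cong (½ ℚ.*_) (trans (ι-+ 0ℤ (+ 2 ℤ.* q i)) (cong (ι 0ℤ ℚ.+_) (ι-* (+ 2) (q i)))) ⟩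
    ½ ℚ.* (ι 0ℤ ℚ.+ ι (+ 2) ℚ.* ι (q i)) ≡⟨ halve (ι (q i)) ⟩
    ι (q i)                           ∎
    where
    halve : ∀ u → ½ ℚ.* (ι 0ℤ ℚ.+ ι (+ 2) ℚ.* u) ≡ u
    halve = solveℚ ℚ-ring
  coordinates : y ≈ addV (scale (ι (q 0F)) e₁) (addV (scale (ι (q 1F)) e₂) (scale (ι (q 2F)) e₃))
  coordinates 0F = trans (y≡q 0F) (solve₀ (ι (q 0F)) (ι (q 1F)) (ι (q 2F)))
    where
    solve₀ : ∀ a b c → a ≡ a ℚ.* ι 1ℤ ℚ.+ (b ℚ.* 0ℚ ℚ.+ c ℚ.* 0ℚ)
    solve₀ = solveℚ ℚ-ring
  coordinates 1F = trans (y≡q 1F) (solve₁ (ι (q 0F)) (ι (q 1F)) (ι (q 2F)))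
    where
    solve₁ : ∀ a b c → b ≡ a ℚ.* 0ℚ ℚ.+ (b ℚ.* ι 1ℤ ℚ.+ c ℚ.* 0ℚ)
    solve₁ = solveℚ ℚ-ring
  coordinates 2F = trans (y≡q 2F) (solve₂ (ι (q 0F)) (ι (q 1F)) (ι (q 2F)))
    where
    solve₂ : ∀ a b c → c ≡ a ℚ.* 0ℚ ℚ.+ (b ℚ.* 0ℚ ℚ.+ c ℚ.* ι 1ℤ)
    solve₂ = solveℚ ℚ-ring

span : ∀ {k} → (Fin k → Class) → Class → Bool
span {ℕ.zero} cs d = isZeroᶜ d
span {ℕ.suc k} cs d = span (cs ∘ suc) d ∨ span (cs ∘ suc) (d ⊕ cs zero)

∨-introˡ : ∀ {x y} → T x → T (x ∨ y)
∨-introˡ p = Equivalence.from T-∨ (inj₁ p)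

∨-introʳ : ∀ {x y} → T y → T (x ∨ y)
∨-introʳ p = Equivalence.from T-∨ (inj₂ p)

∨-elim : ∀ {x y} → T (x ∨ y) → T x ⊎ T y
∨-elim = Equivalence.to T-∨

span-0 : ∀ {k} (cs : Fin k → Class) → T (span cs 0ᶜ)
span-0 {ℕ.zero} cs = tt
span-0 {ℕ.suc k} cs = ∨-introˡ (span-0 (cs ∘ suc))

span-⊕ : ∀ {k} (cs : Fin k → Class) {c d} → T (span cs c) → T (span cs d) → T (span cs (c ⊕ d))
span-⊕ {ℕ.zero} cs {c} {d} c∈ d∈ rewrite isZeroᶜ-sound c c∈ | isZeroᶜ-sound d d∈ = tt
span-⊕ {ℕ.suc k} cs {c} {d} c∈ d∈ with ∨-elim c∈ | ∨-elim d∈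
... | inj₁ c∈′ | inj₁ d∈′ = ∨-introˡ (span-⊕ (cs ∘ suc) c∈′ d∈′)
... | inj₁ c∈′ | inj₂ d∈′ = ∨-introʳ (subst (T ∘ span (cs ∘ suc)) (sym (⊕-assoc c d (cs zero))) (span-⊕ (cs ∘ suc) c∈′ d∈′))
... | inj₂ c∈′ | inj₁ d∈′ = ∨-introʳ (subst (T ∘ span (cs ∘ suc)) (⊕-swapʳ c (cs zero) d) (span-⊕ (cs ∘ suc) c∈′ d∈′))
... | inj₂ c∈′ | inj₂ d∈′ = ∨-introˡ (subst (T ∘ span (cs ∘ suc)) pair (span-⊕ (cs ∘ suc) c∈′ d∈′))
  where
  pair : c ⊕ cs zero ⊕ (d ⊕ cs zero) ≡ c ⊕ d
  pair = begin
    c ⊕ cs zero ⊕ (d ⊕ cs zero)  ≡⟨ ⊕-assoc (c ⊕ cs zero) d (cs zero) ⟨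
    c ⊕ cs zero ⊕ d ⊕ cs zero    ≡⟨ cong (_⊕ cs zero) (⊕-swapʳ c (cs zero) d) ⟩
    c ⊕ d ⊕ cs zero ⊕ cs zero    ≡⟨ ⊕-cancelʳ (c ⊕ d) (cs zero) ⟩
    c ⊕ d                        ∎

span-cons : ∀ {k} (cs : Fin (ℕ.suc k) → Class) {d} → T (span (cs ∘ suc) d) → ∀ p → T (span cs (p ·ᶜ cs zero ⊕ d))
span-cons cs {d} d∈ false = ∨-introˡ (subst (T ∘ span (cs ∘ suc)) (sym (trans (⊕-comm 0ᶜ d) (⊕-identityʳ d))) d∈)
span-cons cs {d} d∈ true = ∨-introʳ (subst (T ∘ span (cs ∘ suc)) (sym cancel) d∈)
  where
  cancel : cs zero ⊕ d ⊕ cs zero ≡ d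
  cancel = trans (⊕-swapʳ (cs zero) d (cs zero)) (trans (cong (_⊕ d) (⊕-self (cs zero))) (trans (⊕-comm 0ᶜ d) (⊕-identityʳ d)))

span-realized : ∀ {k} (g : Fin k → V) (cs : Fin k → Class) → (∀ l → HalfInt (cs l) (g l)) →
  ∀ d → T (span cs d) → Σ V λ w → w ∈⟨ g ⟩ × HalfInt d w
span-realized {ℕ.zero} g cs hg d d∈ = (λ _ → 0ℚ) , ∈⟨⟩-0 {g = g} , subst (λ c → HalfInt c (λ _ → 0ℚ)) (sym (isZeroᶜ-sound d d∈)) HalfInt-0
span-realized {ℕ.suc k} g cs hg d d∈ with ∨-elim d∈
... | inj₁ d∈′ with span-realized (g ∘ suc) (cs ∘ suc) (hg ∘ suc) d d∈′
...   | w , w∈ , hw = w , ∈⟨⟩-tail {g = g} w∈ , hw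
span-realized {ℕ.suc k} g cs hg d d∈ | inj₂ d∈′ with span-realized (g ∘ suc) (cs ∘ suc) (hg ∘ suc) (d ⊕ cs zero) d∈′
...   | w , w∈ , hw = addV w (g zero) , ∈⟨⟩-+ {g = g} (∈⟨⟩-tail {g = g} w∈) (∈⟨⟩-generator g zero) ,
                      subst (λ c → HalfInt c (addV w (g zero))) (⊕-cancelʳ d (cs zero)) (HalfInt-+ hw (hg zero))

span-classifies : ∀ {k} (g : Fin k → V) (cs : Fin k → Class) → (∀ l → HalfInt (cs l) (g l)) →
  ∀ {x} → x ∈⟨ g ⟩ → Σ Class λ d → T (span cs d) × HalfInt d x
span-classifies {ℕ.zero} g cs hg (c , x≈) = 0ᶜ , tt , HalfInt-cong x≈ HalfInt-0
span-classifies {ℕ.suc k} g cs hg (c , x≈)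
  with span-classifies (g ∘ suc) (cs ∘ suc) (hg ∘ suc) {λ i → sumF λ l → ι (c (suc l)) ℚ.* g (suc l) i} (c ∘ suc , λ i → refl)
... | d , d∈ , hd = parity (c zero) ·ᶜ cs zero ⊕ d , span-cons cs d∈ (parity (c zero)) ,
                    HalfInt-cong x≈ (HalfInt-+ (HalfInt-scale (c zero) (hg zero)) hd)

-- Lattices between Λ₃ and ½Λ₃ are determined by their classes

record Λ₃⊆⟨_⟩⊆½Λ₃ {k} (g : Fin k → V) : Set where
  field
    e∈ : ∀ j → e j ∈⟨ g ⟩
    class : Fin k → Class
    halfInt : ∀ l → HalfInt (class l) (g l)

  classes : Class → Bool
  classes = span class

  ∈⟨⟩⇒classes : ∀ {x} → x ∈⟨ g ⟩ → Σ Class λ d → T (classes d) × HalfInt d x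
  ∈⟨⟩⇒classes = span-classifies g class halfInt

  classes-realized : ∀ d → T (classes d) → Σ V λ w → w ∈⟨ g ⟩ × HalfInt d w
  classes-realized = span-realized g class halfInt

  classes⇒∈⟨⟩ : ∀ {d z} → T (classes d) → HalfInt d z → z ∈⟨ g ⟩
  classes⇒∈⟨⟩ {d} {z} d∈ hz with classes-realized d d∈
  ... | w , w∈ , hw = ∈⟨⟩-cong {g = g} (λ i → split (z i) (w i)) (∈⟨⟩-+ {g = g} w∈ (HalfInt-0ᶜ⇒∈⟨⟩ e∈ z-w))
    where
    -- z − w ∈ Λ₃, where w is a vector of the lattice in the same class.
    z-w : HalfInt 0ᶜ (addV z (scale (ι -1ℤ) w))
    z-w = subst (λ c → HalfInt c (addV z (scale (ι -1ℤ) w))) (⊕-self d) (HalfInt-+ hz (HalfInt-scale -1ℤ hw))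
    split : ∀ Z W → Z ≡ W ℚ.+ (Z ℚ.+ ι -1ℤ ℚ.* W)
    split = solveℚ ℚ-ring

Matrix : Set
Matrix = Fin 3 → Fin 3 → ℤ

toℚ : Matrix → Fin 3 → Fin 3 → ℚ
toℚ A i j = ι (A i j)

-- Over 𝔽₂, row gives the action of the reduction of A modulo 2 on classes.
row : Poly 6
row = var 0F :* var 3F :+ (var 1F :* var 4F :+ (var 2F :* var 5F :+ con 0ℤ))

act : Matrix → Class → Class
act A c = classOf (λ i → ⟦ row ⟧₂ ((parity ∘ A i) ++ bits c))

HalfInt-apply : ∀ A {c x} → HalfInt c x → HalfInt (act A c) (apply (toℚ A) x)
HalfInt-apply A {c} {x} (n , x≡ , n-par) = (λ i → ⟦ row ⟧ℤ (A i ++ n)) , coordinate , parities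
  where
  coordinate : ∀ i → apply (toℚ A) x i ≡ ½ ℚ.* ι (⟦ row ⟧ℤ (A i ++ n))
  coordinate i = begin
    apply (toℚ A) x i                             ≡⟨ sum-cong-≗ (λ j → cong (ι (A i j) ℚ.*_) (x≡ j)) ⟩
    sum (λ j → ι (A i j) ℚ.* (½ ℚ.* ι (n j)))     ≡⟨ halves (ι (A i 0F)) (ι (A i 1F)) (ι (A i 2F)) (ι (n 0F)) (ι (n 1F)) (ι (n 2F)) ⟩
    ½ ℚ.* ⟦ row ⟧ℚ (ι ∘ (A i ++ n))               ≡⟨ cong (½ ℚ.*_) (ι-⟦⟧ row (A i ++ n)) ⟨
    ½ ℚ.* ι (⟦ row ⟧ℤ (A i ++ n))                 ∎
    where
    halves : ∀ a₀ a₁ a₂ n₀ n₁ n₂ → a₀ ℚ.* (½ ℚ.* n₀) ℚ.+ (a₁ ℚ.* (½ ℚ.* n₁) ℚ.+ (a₂ ℚ.* (½ ℚ.* n₂) ℚ.+ 0ℚ))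
                                   ≡ ½ ℚ.* (a₀ ℚ.* n₀ ℚ.+ (a₁ ℚ.* n₁ ℚ.+ (a₂ ℚ.* n₂ ℚ.+ ι 0ℤ)))
    halves = solveℚ ℚ-ring
  parities : ∀ i → ⟦ row ⟧ℤ (A i ++ n) hasParity bits (act A c) i
  parities i = subst (⟦ row ⟧ℤ (A i ++ n) hasParity_) (sym (bits-classOf (λ i → ⟦ row ⟧₂ ((parity ∘ A i) ++ bits c)) i))
    (hasParity-⟦⟧ row {A i ++ n} (hasParity-++ (hasParity-parity ∘ A i) n-par))

gram : (Fin 3 → Fin 3 → ℚ) → Fin 3 → Fin 3 → ℚ
gram A k l = sum λ i → sum λ j → A i k ℚ.* (G i j ℚ.* A j l)

∑⁴-reorder : ∀ {m n p q} (F : Fin m → Fin n → Fin p → Fin q → ℚ) →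
  (sum λ i → sum λ j → sum λ k → sum λ l → F i j k l) ≡ (sum λ k → sum λ l → sum λ i → sum λ j → F i j k l)
∑⁴-reorder F = begin
  (sum λ i → sum λ j → sum λ k → sum λ l → F i j k l)  ≡⟨ sum-cong-≗ (λ i → ∑-comm (λ j k → sum λ l → F i j k l)) ⟩
  (sum λ i → sum λ k → sum λ j → sum λ l → F i j k l)  ≡⟨ ∑-comm (λ i k → sum λ j → sum λ l → F i j k l) ⟩
  (sum λ k → sum λ i → sum λ j → sum λ l → F i j k l)  ≡⟨ sum-cong-≗ (λ k → sum-cong-≗ (λ i → ∑-comm (λ j l → F i j k l))) ⟩
  (sum λ k → sum λ i → sum λ l → sum λ j → F i j k l)  ≡⟨ sum-cong-≗ (λ k → ∑-comm (λ i l → sum λ j → F i j k l)) ⟩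
  (sum λ k → sum λ l → sum λ i → sum λ j → F i j k l)  ∎

∑²-factor : ∀ {m n} x y (M : Fin m → Fin n → ℚ) →
  (sum λ i → sum λ j → x ℚ.* (M i j ℚ.* y)) ≡ x ℚ.* ((sum λ i → sum λ j → M i j) ℚ.* y)
∑²-factor x y M = begin
  (sum λ i → sum λ j → x ℚ.* (M i j ℚ.* y))  ≡⟨ sum-cong-≗ (λ i → *-distribˡ-sum x (λ j → M i j ℚ.* y)) ⟨
  (sum λ i → x ℚ.* sum λ j → M i j ℚ.* y)    ≡⟨ *-distribˡ-sum x (λ i → sum λ j → M i j ℚ.* y) ⟨
  x ℚ.* (sum λ i → sum λ j → M i j ℚ.* y)    ≡⟨ cong (x ℚ.*_) (sum-cong-≗ (λ i → Σℚ.*-distribʳ-sum y (M i))) ⟨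
  x ℚ.* (sum λ i → (sum λ j → M i j) ℚ.* y)  ≡⟨ cong (x ℚ.*_) (Σℚ.*-distribʳ-sum y (λ i → sum λ j → M i j)) ⟨
  x ℚ.* ((sum λ i → sum λ j → M i j) ℚ.* y)  ∎

product-of-sums : ∀ {m n} (a : Fin m → ℚ) (x : Fin m → ℚ) g (b : Fin n → ℚ) (y : Fin n → ℚ) →
  (sum λ k → a k ℚ.* x k) ℚ.* (g ℚ.* sum λ l → b l ℚ.* y l) ≡ (sum λ k → sum λ l → x k ℚ.* ((a k ℚ.* (g ℚ.* b l)) ℚ.* y l))
product-of-sums a x g b y = begin
  (sum λ k → a k ℚ.* x k) ℚ.* (g ℚ.* sum λ l → b l ℚ.* y l)        ≡⟨ Σℚ.*-distribʳ-sum _ (λ k → a k ℚ.* x k) ⟩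
  (sum λ k → a k ℚ.* x k ℚ.* (g ℚ.* sum λ l → b l ℚ.* y l))        ≡⟨ sum-cong-≗ (λ k → cong (a k ℚ.* x k ℚ.*_) (*-distribˡ-sum g (λ l → b l ℚ.* y l))) ⟩
  (sum λ k → a k ℚ.* x k ℚ.* sum λ l → g ℚ.* (b l ℚ.* y l))        ≡⟨ sum-cong-≗ (λ k → *-distribˡ-sum (a k ℚ.* x k) (λ l → g ℚ.* (b l ℚ.* y l))) ⟩
  (sum λ k → sum λ l → a k ℚ.* x k ℚ.* (g ℚ.* (b l ℚ.* y l)))       ≡⟨ sum-cong-≗ (λ k → sum-cong-≗ (λ l → rearrange (a k) (x k) g (b l) (y l))) ⟩
  (sum λ k → sum λ l → x k ℚ.* ((a k ℚ.* (g ℚ.* b l)) ℚ.* y l))     ∎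
  where
  rearrange : ∀ a x g b y → a ℚ.* x ℚ.* (g ℚ.* (b ℚ.* y)) ≡ x ℚ.* ((a ℚ.* (g ℚ.* b)) ℚ.* y)
  rearrange = solveℚ ℚ-ring

⟪⟫-apply : ∀ A x y → ⟪ apply A x , apply A y ⟫ ≡ (sum λ k → sum λ l → x k ℚ.* (gram A k l ℚ.* y l))
⟪⟫-apply A x y = begin
  ⟪ apply A x , apply A y ⟫
    ≡⟨ sum-cong-≗ (λ i → sum-cong-≗ (λ j → product-of-sums (A i) x (G i j) (A j) y)) ⟩
  (sum λ i → sum λ j → sum λ k → sum λ l → x k ℚ.* ((A i k ℚ.* (G i j ℚ.* A j l)) ℚ.* y l))
    ≡⟨ ∑⁴-reorder (λ i j k l → x k ℚ.* ((A i k ℚ.* (G i j ℚ.* A j l)) ℚ.* y l)) ⟩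
  (sum λ k → sum λ l → sum λ i → sum λ j → x k ℚ.* ((A i k ℚ.* (G i j ℚ.* A j l)) ℚ.* y l))
    ≡⟨ sum-cong-≗ (λ k → sum-cong-≗ (λ l → ∑²-factor (x k) (y l) (λ i j → A i k ℚ.* (G i j ℚ.* A j l)))) ⟩
  (sum λ k → sum λ l → x k ℚ.* (gram A k l ℚ.* y l))  ∎

isometry-by-gram : ∀ A → (∀ k l → gram A k l ≡ G k l) → ∀ x y → ⟪ apply A x , apply A y ⟫ ≡ ⟪ x , y ⟫
isometry-by-gram A gram≡G x y =
  trans (⟪⟫-apply A x y) (sum-cong-≗ (λ k → sum-cong-≗ (λ l → cong (λ u → x k ℚ.* (u ℚ.* y l)) (gram≡G k l))))

sum-e : ∀ i (y : V) → (sum λ k → y k ℚ.* e i k) ≡ y i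
sum-e 0F y = pick₀ (y 0F) (y 1F) (y 2F)
  where
  pick₀ : ∀ a b c → a ℚ.* ι 1ℤ ℚ.+ (b ℚ.* 0ℚ ℚ.+ (c ℚ.* 0ℚ ℚ.+ 0ℚ)) ≡ a
  pick₀ = solveℚ ℚ-ring
sum-e 1F y = pick₁ (y 0F) (y 1F) (y 2F)
  where
  pick₁ : ∀ a b c → a ℚ.* 0ℚ ℚ.+ (b ℚ.* ι 1ℤ ℚ.+ (c ℚ.* 0ℚ ℚ.+ 0ℚ)) ≡ b
  pick₁ = solveℚ ℚ-ring
sum-e 2F y = pick₂ (y 0F) (y 1F) (y 2F)
  where
  pick₂ : ∀ a b c → a ℚ.* 0ℚ ℚ.+ (b ℚ.* 0ℚ ℚ.+ (c ℚ.* ι 1ℤ ℚ.+ 0ℚ)) ≡ c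
  pick₂ = solveℚ ℚ-ring

involutive-by-square : ∀ A → (∀ i k → (sum λ j → A i j ℚ.* A j k) ≡ e i k) → ∀ y → apply A (apply A y) ≈ y
involutive-by-square A square≡I y i = begin
  (sum λ j → A i j ℚ.* sum λ k → A j k ℚ.* y k)          ≡⟨ sum-cong-≗ (λ j → *-distribˡ-sum (A i j) (λ k → A j k ℚ.* y k)) ⟩
  (sum λ j → sum λ k → A i j ℚ.* (A j k ℚ.* y k))        ≡⟨ ∑-comm (λ j k → A i j ℚ.* (A j k ℚ.* y k)) ⟩
  (sum λ k → sum λ j → A i j ℚ.* (A j k ℚ.* y k))        ≡⟨ sum-cong-≗ (λ k → sum-cong-≗ (λ j → sym (ℚP.*-assoc (A i j) (A j k) (y k)))) ⟩
  (sum λ k → sum λ j → A i j ℚ.* A j k ℚ.* y k)          ≡⟨ sum-cong-≗ (λ k → Σℚ.*-distribʳ-sum (y k) (λ j → A i j ℚ.* A j k)) ⟨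
  (sum λ k → (sum λ j → A i j ℚ.* A j k) ℚ.* y k)        ≡⟨ sum-cong-≗ (λ k → trans (cong (ℚ._* y k) (square≡I i k)) (ℚP.*-comm (e i k) (y k))) ⟩
  (sum λ k → y k ℚ.* e i k)                              ≡⟨ sum-e i y ⟩
  y i                                                    ∎

record Involution : Set where
  field
    matrix : Matrix
    preserves-G : ∀ k l → gram (toℚ matrix) k l ≡ G k l
    squares-to-I : ∀ i k → (sum λ j → toℚ matrix i j ℚ.* toℚ matrix j k) ≡ e i k

involution : (M : Matrix) →
  {True (all? λ k → all? λ l → gram (toℚ M) k l ℚP.≟ G k l)} →
  {True (all? λ i → all? λ k → (sum λ j → toℚ M i j ℚ.* toℚ M j k) ℚP.≟ e i k)} → Involution
involution M {isometry} {square} = record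
  { matrix = M ; preserves-G = toWitness isometry ; squares-to-I = toWitness square }

_maps_into_ : Involution → (Class → Bool) → (Class → Bool) → Set
σ maps S into S′ = ∀ c → T (S c) → T (S′ (act (Involution.matrix σ) c))

module _ {k m} {g : Fin k → V} {h : Fin m → V} (L : Λ₃⊆⟨ g ⟩⊆½Λ₃) (L′ : Λ₃⊆⟨ h ⟩⊆½Λ₃) where
  open Λ₃⊆⟨_⟩⊆½Λ₃

  isometric-via : (σ : Involution) → σ maps classes L into classes L′ → σ maps classes L′ into classes L → Isometric g h
  isometric-via σ forth back = toℚ M , isometry-by-gram (toℚ M) (Involution.preserves-G σ) , image , preimage
    where
    M = Involution.matrix σ
    image : ∀ x → x ∈⟨ g ⟩ → apply (toℚ M) x ∈⟨ h ⟩
    image x x∈ with ∈⟨⟩⇒classes L x∈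
    ... | d , d∈ , hx = classes⇒∈⟨⟩ L′ (forth d d∈) (HalfInt-apply M hx)
    preimage : ∀ y → y ∈⟨ h ⟩ → Σ V λ x → x ∈⟨ g ⟩ × (apply (toℚ M) x ≈ y)
    preimage y y∈ with ∈⟨⟩⇒classes L′ y∈
    ... | d , d∈ , hy = apply (toℚ M) y , classes⇒∈⟨⟩ L (back d d∈) (HalfInt-apply M hy) ,
                        involutive-by-square (toℚ M) (Involution.squares-to-I σ) y


-- Integral products with Λ₃ and integral norm force a vector into ½Λ₃

Gx : V → V
Gx x 0F = ι (+ 4) ℚ.* x 0F ℚ.+ ι -[1+ 1 ] ℚ.* x 1F
Gx x 1F = ι -[1+ 1 ] ℚ.* x 0F ℚ.+ ι (+ 4) ℚ.* x 1F ℚ.+ ι -[1+ 1 ] ℚ.* x 2F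
Gx x 2F = ι -[1+ 1 ] ℚ.* x 1F ℚ.+ ι (+ 4) ℚ.* x 2F

⟪⟫≡Gx : ∀ x y → ⟪ x , y ⟫ ≡ sum λ j → Gx x j ℚ.* y j
⟪⟫≡Gx x y = expand (x 0F) (x 1F) (x 2F) (y 0F) (y 1F) (y 2F)
  where
  expand : ∀ a b c d e f →
    a ℚ.* (ι (+ 4) ℚ.* d) ℚ.+ (a ℚ.* (ι -[1+ 1 ] ℚ.* e) ℚ.+ (a ℚ.* (ι (+ 0) ℚ.* f) ℚ.+ 0ℚ)) ℚ.+
    (b ℚ.* (ι -[1+ 1 ] ℚ.* d) ℚ.+ (b ℚ.* (ι (+ 4) ℚ.* e) ℚ.+ (b ℚ.* (ι -[1+ 1 ] ℚ.* f) ℚ.+ 0ℚ)) ℚ.+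
    (c ℚ.* (ι (+ 0) ℚ.* d) ℚ.+ (c ℚ.* (ι -[1+ 1 ] ℚ.* e) ℚ.+ (c ℚ.* (ι (+ 4) ℚ.* f) ℚ.+ 0ℚ)) ℚ.+ 0ℚ))
    ≡ (ι (+ 4) ℚ.* a ℚ.+ ι -[1+ 1 ] ℚ.* b) ℚ.* d ℚ.+
      ((ι -[1+ 1 ] ℚ.* a ℚ.+ ι (+ 4) ℚ.* b ℚ.+ ι -[1+ 1 ] ℚ.* c) ℚ.* e ℚ.+
      ((ι -[1+ 1 ] ℚ.* b ℚ.+ ι (+ 4) ℚ.* c) ℚ.* f ℚ.+ 0ℚ))
  expand = solveℚ ℚ-ring

⟪⟫-cong : ∀ {x x′ y y′} → x ≈ x′ → y ≈ y′ → ⟪ x , y ⟫ ≡ ⟪ x′ , y′ ⟫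
⟪⟫-cong x≈ y≈ = sum-cong-≗ (λ i → sum-cong-≗ (λ j → cong₂ (λ a b → a ℚ.* (G i j ℚ.* b)) (x≈ i) (y≈ j)))

⟪⟫-e : ∀ x j → ⟪ x , e j ⟫ ≡ Gx x j
⟪⟫-e x j = trans (⟪⟫≡Gx x (e j)) (sum-e j (Gx x))

-- The rows of 8 G⁻¹, and the quadratic form of 8 G⁻¹
L : Fin 3 → Poly 3
L 0F = con (+ 3) :* var 0F :+ con (+ 2) :* var 1F :+ var 2F
L 1F = con (+ 2) :* var 0F :+ con (+ 4) :* var 1F :+ con (+ 2) :* var 2F
L 2F = var 0F :+ con (+ 2) :* var 1F :+ con (+ 3) :* var 2F

Q : Poly 3
Q = var 0F :* L 0F :+ var 1F :* L 1F :+ var 2F :* L 2F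

8x≡L[Gx] : ∀ x i → ι (+ 8) ℚ.* x i ≡ ⟦ L i ⟧ℚ (Gx x)
8x≡L[Gx] x 0F = solve (x 0F) (x 1F) (x 2F)
  where
  solve : ∀ a b c → ι (+ 8) ℚ.* a ≡
    ι (+ 3) ℚ.* (ι (+ 4) ℚ.* a ℚ.+ ι -[1+ 1 ] ℚ.* b) ℚ.+ ι (+ 2) ℚ.* (ι -[1+ 1 ] ℚ.* a ℚ.+ ι (+ 4) ℚ.* b ℚ.+ ι -[1+ 1 ] ℚ.* c)
    ℚ.+ (ι -[1+ 1 ] ℚ.* b ℚ.+ ι (+ 4) ℚ.* c)
  solve = solveℚ ℚ-ring
8x≡L[Gx] x 1F = solve (x 0F) (x 1F) (x 2F)
  where
  solve : ∀ a b c → ι (+ 8) ℚ.* b ≡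
    ι (+ 2) ℚ.* (ι (+ 4) ℚ.* a ℚ.+ ι -[1+ 1 ] ℚ.* b) ℚ.+ ι (+ 4) ℚ.* (ι -[1+ 1 ] ℚ.* a ℚ.+ ι (+ 4) ℚ.* b ℚ.+ ι -[1+ 1 ] ℚ.* c)
    ℚ.+ ι (+ 2) ℚ.* (ι -[1+ 1 ] ℚ.* b ℚ.+ ι (+ 4) ℚ.* c)
  solve = solveℚ ℚ-ring
8x≡L[Gx] x 2F = solve (x 0F) (x 1F) (x 2F)
  where
  solve : ∀ a b c → ι (+ 8) ℚ.* c ≡
    (ι (+ 4) ℚ.* a ℚ.+ ι -[1+ 1 ] ℚ.* b) ℚ.+ ι (+ 2) ℚ.* (ι -[1+ 1 ] ℚ.* a ℚ.+ ι (+ 4) ℚ.* b ℚ.+ ι -[1+ 1 ] ℚ.* c)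
    ℚ.+ ι (+ 3) ℚ.* (ι -[1+ 1 ] ℚ.* b ℚ.+ ι (+ 4) ℚ.* c)
  solve = solveℚ ℚ-ring

8⟪x,x⟫≡Q[Gx] : ∀ x → ι (+ 8) ℚ.* ⟪ x , x ⟫ ≡ ⟦ Q ⟧ℚ (Gx x)
8⟪x,x⟫≡Q[Gx] x = begin
  ι (+ 8) ℚ.* ⟪ x , x ⟫                                                  ≡⟨ cong (ι (+ 8) ℚ.*_) (⟪⟫≡Gx x x) ⟩
  ι (+ 8) ℚ.* (sum λ j → Gx x j ℚ.* x j)                                 ≡⟨ regroup (Gx x 0F) (Gx x 1F) (Gx x 2F) (x 0F) (x 1F) (x 2F) ⟩
  g 0F ℚ.* (ι (+ 8) ℚ.* x 0F) ℚ.+ g 1F ℚ.* (ι (+ 8) ℚ.* x 1F) ℚ.+ g 2F ℚ.* (ι (+ 8) ℚ.* x 2F)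
    ≡⟨ cong₂ ℚ._+_ (cong₂ ℚ._+_ (cong (g 0F ℚ.*_) (8x≡L[Gx] x 0F)) (cong (g 1F ℚ.*_) (8x≡L[Gx] x 1F))) (cong (g 2F ℚ.*_) (8x≡L[Gx] x 2F)) ⟩
  ⟦ Q ⟧ℚ (Gx x)                                                          ∎
  where
  g = Gx x
  regroup : ∀ g₀ g₁ g₂ a b c → ι (+ 8) ℚ.* (g₀ ℚ.* a ℚ.+ (g₁ ℚ.* b ℚ.+ (g₂ ℚ.* c ℚ.+ 0ℚ))) ≡
    g₀ ℚ.* (ι (+ 8) ℚ.* a) ℚ.+ g₁ ℚ.* (ι (+ 8) ℚ.* b) ℚ.+ g₂ ℚ.* (ι (+ 8) ℚ.* c)
  regroup = solveℚ ℚ-ring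

residue : Fin 8 → Fin 8 → Fin 8 → Fin 3 → ℤ
residue r s t 0F = + toℕ r
residue r s t 1F = + toℕ s
residue r s t 2F = + toℕ t

residue-check : ∀ r s t → + 8 ∣ ⟦ Q ⟧ℤ (residue r s t) → ∀ i → + 4 ∣ ⟦ L i ⟧ℤ (residue r s t)
residue-check = toWitness {a? = all? λ r → all? λ s → all? λ t →
  (+ 8 ∣? ⟦ Q ⟧ℤ (residue r s t)) →-dec all? λ i → + 4 ∣? ⟦ L i ⟧ℤ (residue r s t)} tt

-- Q and L are polynomials, so modulo 8 they only depend on the residues of α modulo 8.
8∣Q⇒4∣L : ∀ α → + 8 ∣ ⟦ Q ⟧ℤ α → ∀ i → + 4 ∣ ⟦ L i ⟧ℤ α
8∣Q⇒4∣L α 8∣Qα i = subst (+ 4 ∣_) (sym Lα≡) (∣m∣n⇒∣m+n 4∣Lρ (∣m⇒∣m*n d (divides (+ 2) refl)))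
  where
  r : Fin 3 → Fin 8
  r j = fromℕ< (ℤDM.n%ℕd<d (α j) 8)
  ρ : Fin 3 → ℤ
  ρ = residue (r 0F) (r 1F) (r 2F)
  α≡ρ+8w : ∀ j → α j ≡ ρ j ℤ.+ + 8 ℤ.* (α j ℤDM./ℕ 8)
  α≡ρ+8w j = trans (ℤDM.a≡a%ℕn+[a/ℕn]*n (α j) 8)
    (cong₂ ℤ._+_ (trans (cong +_ (sym (toℕ-fromℕ< _))) (ρ≡ j)) (ℤP.*-comm (α j ℤDM./ℕ 8) (+ 8)))
    where
    ρ≡ : ∀ j → + toℕ (r j) ≡ ρ j
    ρ≡ 0F = refl
    ρ≡ 1F = refl
    ρ≡ 2F = refl
  congruent : ∀ p → ∃ λ c → ⟦ p ⟧ℤ α ≡ ⟦ p ⟧ℤ ρ ℤ.+ + 8 ℤ.* c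
  congruent p = ⟦⟧ℤ-congruent (+ 8) p {α} {ρ} {λ j → α j ℤDM./ℕ 8} α≡ρ+8w
  c = proj₁ (congruent Q)
  Qα≡ = proj₂ (congruent Q)
  d = proj₁ (congruent (L i))
  Lα≡ = proj₂ (congruent (L i))
  8∣Qρ : + 8 ∣ ⟦ Q ⟧ℤ ρ
  8∣Qρ = ∣m+n∣n⇒∣m (subst (+ 8 ∣_) Qα≡ 8∣Qα) (∣m⇒∣m*n c ∣-refl)
  4∣Lρ : + 4 ∣ ⟦ L i ⟧ℤ ρ
  4∣Lρ = residue-check (r 0F) (r 1F) (r 2F) 8∣Qρ i

integral-products⇒∈½Λ₃ : ∀ x → (∀ j → IsInt ⟪ x , e j ⟫) → IsInt ⟪ x , x ⟫ →
  Σ (Fin 3 → ℤ) λ n → ∀ i → x i ≡ ½ ℚ.* ι (n i)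
integral-products⇒∈½Λ₃ x int-e (ν , ⟪x,x⟫≡ν) = n , x≡½n
  where
  α : Fin 3 → ℤ
  α j = proj₁ (int-e j)
  Gx≡α : ∀ j → Gx x j ≡ ι (α j)
  Gx≡α j = trans (sym (⟪⟫-e x j)) (proj₂ (int-e j))
  ⟦⟧[Gx] : ∀ p → ⟦ p ⟧ℚ (Gx x) ≡ ι (⟦ p ⟧ℤ α)
  ⟦⟧[Gx] p = trans (⟦⟧ℚ-cong p Gx≡α) (sym (ι-⟦⟧ p α))
  Qα≡8ν : ⟦ Q ⟧ℤ α ≡ + 8 ℤ.* ν
  Qα≡8ν = ι-injective (begin
    ι (⟦ Q ⟧ℤ α)           ≡⟨ ⟦⟧[Gx] Q ⟨
    ⟦ Q ⟧ℚ (Gx x)          ≡⟨ 8⟪x,x⟫≡Q[Gx] x ⟨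
    ι (+ 8) ℚ.* ⟪ x , x ⟫  ≡⟨ cong (ι (+ 8) ℚ.*_) ⟪x,x⟫≡ν ⟩
    ι (+ 8) ℚ.* ι ν        ≡⟨ ι-* (+ 8) ν ⟨
    ι (+ 8 ℤ.* ν)          ∎)
  4∣Lα : ∀ i → + 4 ∣ ⟦ L i ⟧ℤ α
  4∣Lα = 8∣Q⇒4∣L α (divides ν (trans Qα≡8ν (ℤP.*-comm (+ 8) ν)))
  n : Fin 3 → ℤ
  n i = _∣_.quotient (4∣Lα i)
  x≡½n : ∀ i → x i ≡ ½ ℚ.* ι (n i)
  x≡½n i = begin
    x i                                ≡⟨ eighth (x i) ⟩
    (+ 1 ℚ./ 8) ℚ.* (ι (+ 8) ℚ.* x i)  ≡⟨ cong ((+ 1 ℚ./ 8) ℚ.*_) (trans (8x≡L[Gx] x i) (⟦⟧[Gx] (L i))) ⟩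
    (+ 1 ℚ./ 8) ℚ.* ι (⟦ L i ⟧ℤ α)     ≡⟨ cong (λ m → (+ 1 ℚ./ 8) ℚ.* ι m) (_∣_.equality (4∣Lα i)) ⟩
    (+ 1 ℚ./ 8) ℚ.* ι (n i ℤ.* + 4)    ≡⟨ cong ((+ 1 ℚ./ 8) ℚ.*_) (ι-* (n i) (+ 4)) ⟩
    (+ 1 ℚ./ 8) ℚ.* (ι (n i) ℚ.* ι (+ 4)) ≡⟨ quarter (ι (n i)) ⟩
    ½ ℚ.* ι (n i)                      ∎
    where
    eighth : ∀ u → u ≡ (+ 1 ℚ./ 8) ℚ.* (ι (+ 8) ℚ.* u)
    eighth = solveℚ ℚ-ring
    quarter : ∀ w → (+ 1 ℚ./ 8) ℚ.* (w ℚ.* ι (+ 4)) ≡ ½ ℚ.* w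
    quarter = solveℚ ℚ-ring

HalfInt-of : ∀ n {x} → (∀ i → x i ≡ ½ ℚ.* ι (n i)) → HalfInt (classOf (parity ∘ n)) x
HalfInt-of n x≡ = n , x≡ , λ i → subst (n i hasParity_) (sym (bits-classOf (parity ∘ n) i)) (hasParity-parity (n i))

-- For x = ½n and y = ½m, ⟪x,y⟫ = n·m − ½ cross(n,m); so c · d is 2⟪x,y⟫ mod 2.
dot cross : Poly 6
dot = var 0F :* var 3F :+ var 1F :* var 4F :+ var 2F :* var 5F
cross = var 0F :* var 4F :+ var 1F :* var 3F :+ var 1F :* var 5F :+ var 2F :* var 4F

_·_ : Class → Class → Bool
c · d = ⟦ cross ⟧₂ (bits c ++ bits d)

⟪½n,½m⟫ : ∀ n m → ⟪ (λ i → ½ ℚ.* ι (n i)) , (λ i → ½ ℚ.* ι (m i)) ⟫ ≡ ι (⟦ dot ⟧ℤ (n ++ m)) ℚ.- ½ ℚ.* ι (⟦ cross ⟧ℤ (n ++ m))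
⟪½n,½m⟫ n m = begin
  ⟪ (λ i → ½ ℚ.* ι (n i)) , (λ i → ½ ℚ.* ι (m i)) ⟫               ≡⟨ ⟪⟫≡Gx (λ i → ½ ℚ.* ι (n i)) (λ i → ½ ℚ.* ι (m i)) ⟩
  (sum λ j → Gx (λ i → ½ ℚ.* ι (n i)) j ℚ.* (½ ℚ.* ι (m j)))      ≡⟨ solve (ι (n 0F)) (ι (n 1F)) (ι (n 2F)) (ι (m 0F)) (ι (m 1F)) (ι (m 2F)) ⟩
  ⟦ dot ⟧ℚ (ι ∘ (n ++ m)) ℚ.- ½ ℚ.* ⟦ cross ⟧ℚ (ι ∘ (n ++ m))      ≡⟨ cong₂ (λ u w → u ℚ.- ½ ℚ.* w) (ι-⟦⟧ dot (n ++ m)) (ι-⟦⟧ cross (n ++ m)) ⟨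
  ι (⟦ dot ⟧ℤ (n ++ m)) ℚ.- ½ ℚ.* ι (⟦ cross ⟧ℤ (n ++ m))          ∎
  where
  solve : ∀ a₀ a₁ a₂ b₀ b₁ b₂ →
    (ι (+ 4) ℚ.* (½ ℚ.* a₀) ℚ.+ ι -[1+ 1 ] ℚ.* (½ ℚ.* a₁)) ℚ.* (½ ℚ.* b₀) ℚ.+
    ((ι -[1+ 1 ] ℚ.* (½ ℚ.* a₀) ℚ.+ ι (+ 4) ℚ.* (½ ℚ.* a₁) ℚ.+ ι -[1+ 1 ] ℚ.* (½ ℚ.* a₂)) ℚ.* (½ ℚ.* b₁) ℚ.+
    ((ι -[1+ 1 ] ℚ.* (½ ℚ.* a₁) ℚ.+ ι (+ 4) ℚ.* (½ ℚ.* a₂)) ℚ.* (½ ℚ.* b₂) ℚ.+ 0ℚ))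
    ≡ (a₀ ℚ.* b₀ ℚ.+ a₁ ℚ.* b₁ ℚ.+ a₂ ℚ.* b₂) ℚ.- ½ ℚ.* (a₀ ℚ.* b₁ ℚ.+ a₁ ℚ.* b₀ ℚ.+ a₁ ℚ.* b₂ ℚ.+ a₂ ℚ.* b₁)
  solve = solveℚ ℚ-ring

D-½S-integral⇒S-even : ∀ {D S z} → ι z ≡ ι D ℚ.- ½ ℚ.* ι S → S hasParity false
D-½S-integral⇒S-even {D} {S} {z} z≡D-½S = parityWitness (D ℤ.- z) (begin
  S                                    ≡⟨ solve₁ S z ⟩
  S ℤ.+ + 2 ℤ.* z ℤ.- + 2 ℤ.* z        ≡⟨ cong (ℤ._- + 2 ℤ.* z) S+2z≡2D ⟩
  + 2 ℤ.* D ℤ.- + 2 ℤ.* z              ≡⟨ solve₂ D z ⟩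
  0ℤ ℤ.+ + 2 ℤ.* (D ℤ.- z)             ∎)
  where
  S+2z≡2D : S ℤ.+ + 2 ℤ.* z ≡ + 2 ℤ.* D
  S+2z≡2D = ι-injective (begin
    ι (S ℤ.+ + 2 ℤ.* z)                      ≡⟨ trans (ι-+ S _) (cong (ι S ℚ.+_) (ι-* (+ 2) z)) ⟩
    ι S ℚ.+ ι (+ 2) ℚ.* ι z                  ≡⟨ cong (λ u → ι S ℚ.+ ι (+ 2) ℚ.* u) z≡D-½S ⟩
    ι S ℚ.+ ι (+ 2) ℚ.* (ι D ℚ.- ½ ℚ.* ι S)  ≡⟨ solve (ι S) (ι D) ⟩
    ι (+ 2) ℚ.* ι D                          ≡⟨ ι-* (+ 2) D ⟨
    ι (+ 2 ℤ.* D)                            ∎)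
    where
    solve : ∀ s d → s ℚ.+ ι (+ 2) ℚ.* (d ℚ.- ½ ℚ.* s) ≡ ι (+ 2) ℚ.* d
    solve = solveℚ ℚ-ring
  solve₁ : ∀ s z → s ≡ s ℤ.+ + 2 ℤ.* z ℤ.- + 2 ℤ.* z
  solve₁ = solveℤ
  solve₂ : ∀ d z → + 2 ℤ.* d ℤ.- + 2 ℤ.* z ≡ 0ℤ ℤ.+ + 2 ℤ.* (d ℤ.- z)
  solve₂ = solveℤ

integral⇒orthogonal : ∀ {c d x y} → HalfInt c x → HalfInt d y → IsInt ⟪ x , y ⟫ → c · d ≡ false
integral⇒orthogonal {x = x} {y} (n , x≡ , n-par) (m , y≡ , m-par) (z , ⟪x,y⟫≡z) =
  hasParity-unique (hasParity-⟦⟧ cross (hasParity-++ n-par m-par)) (D-½S-integral⇒S-even {⟦ dot ⟧ℤ (n ++ m)} {⟦ cross ⟧ℤ (n ++ m)} {z} (begin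
    ι z                                                 ≡⟨ ⟪x,y⟫≡z ⟨
    ⟪ x , y ⟫                                           ≡⟨ ⟪⟫-cong {y′ = λ i → ½ ℚ.* ι (m i)} x≡ y≡ ⟩
    ⟪ (λ i → ½ ℚ.* ι (n i)) , (λ i → ½ ℚ.* ι (m i)) ⟫   ≡⟨ ⟪½n,½m⟫ n m ⟩
    ι (⟦ dot ⟧ℤ (n ++ m)) ℚ.- ½ ℚ.* ι (⟦ cross ⟧ℤ (n ++ m)) ∎))

allBool : (Bool → Bool) → Bool
allBool P = P false ∧ P true

allBool-sound : ∀ P → T (allBool P) → ∀ b → T (P b)
allBool-sound P t false = proj₁ (Equivalence.to T-∧ t)
allBool-sound P t true = proj₂ (Equivalence.to (T-∧ {P false}) t)

allBool-complete : ∀ {P} → (∀ b → T (P b)) → T (allBool P)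
allBool-complete p = Equivalence.from T-∧ (p false , p true)

allᶜ : (Class → Bool) → Bool
allᶜ P = allBool λ a → allBool λ b → allBool λ c → P (a , b , c)

allᶜ-sound : ∀ P → T (allᶜ P) → ∀ c → T (P c)
allᶜ-sound P t (a , b , c) =
  allBool-sound (λ c → P (a , b , c)) (allBool-sound (λ b → allBool λ c → P (a , b , c)) (allBool-sound (λ a → allBool λ b → allBool λ c → P (a , b , c)) t a) b) c

allᶜ-complete : ∀ {P} → (∀ c → T (P c)) → T (allᶜ P)
allᶜ-complete p = allBool-complete λ a → allBool-complete λ b → allBool-complete λ c → p (a , b , c)

allVec : ∀ n → (Vec Bool n → Bool) → Bool
allVec ℕ.zero P = P Vec.[]
allVec (ℕ.suc n) P = allBool λ b → allVec n (λ bs → P (b Vec.∷ bs))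

allVec-sound : ∀ n P → T (allVec n P) → ∀ bs → T (P bs)
allVec-sound ℕ.zero P t Vec.[] = t
allVec-sound (ℕ.suc n) P t (b Vec.∷ bs) = allVec-sound n (λ bs → P (b Vec.∷ bs)) (allBool-sound (λ b → allVec n (λ bs → P (b Vec.∷ bs))) t b) bs

table : (Class → Bool) → Vec Bool 8
table S = Vec.map S (  (false , false , false) Vec.∷ (false , false , true) Vec.∷ (false , true , false) Vec.∷ (false , true , true)
                 Vec.∷ (true , false , false) Vec.∷ (true , false , true) Vec.∷ (true , true , false) Vec.∷ (true , true , true) Vec.∷ Vec.[])

fromTable : Vec Bool 8 → Class → Bool
fromTable bs (a , b , c) = Vec.lookup bs (index a b c)
  where
  index : Bool → Bool → Bool → Fin 8
  index false false false = 0F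
  index false false true = 1F
  index false true false = 2F
  index false true true = 3F
  index true false false = 4F
  index true false true = 5F
  index true true false = 6F
  index true true true = 7F

fromTable-table : ∀ S c → fromTable (table S) c ≡ S c
fromTable-table S (false , false , false) = refl
fromTable-table S (false , false , true) = refl
fromTable-table S (false , true , false) = refl
fromTable-table S (false , true , true) = refl
fromTable-table S (true , false , false) = refl
fromTable-table S (true , false , true) = refl
fromTable-table S (true , true , false) = refl
fromTable-table S (true , true , true) = refl

allᶜ-cong : ∀ {P P′} → (∀ c → P c ≡ P′ c) → allᶜ P ≡ allᶜ P′
allᶜ-cong P≡ = cong₂ _∧_ (cong₂ _∧_ (cong₂ _∧_ (P≡ _) (P≡ _)) (cong₂ _∧_ (P≡ _) (P≡ _)))
                         (cong₂ _∧_ (cong₂ _∧_ (P≡ _) (P≡ _)) (cong₂ _∧_ (P≡ _) (P≡ _)))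

allSubsets-sound : ∀ {P : (Class → Bool) → Bool} → T (allVec 8 (P ∘ fromTable)) → ∀ S → T (P (fromTable (table S)))
allSubsets-sound {P} t S = allVec-sound 8 (P ∘ fromTable) t (table S)

implies : ∀ {x y} → (T x → T y) → T (not x ∨ y)
implies {false} _ = tt
implies {true} f = f tt

modus-ponens : ∀ {x y} → T (not x ∨ y) → T x → T y
modus-ponens {true} t _ = t

isotropic-subgroup? : (Class → Bool) → Bool
isotropic-subgroup? S = S 0ᶜ ∧ allᶜ λ c → allᶜ λ d → not (S c ∧ S d) ∨ (S (c ⊕ d) ∧ not (c · d))

isotropic-subgroup?-cong : ∀ {S S′} → (∀ c → S c ≡ S′ c) → isotropic-subgroup? S ≡ isotropic-subgroup? S′
isotropic-subgroup?-cong S≡ = cong₂ _∧_ (S≡ 0ᶜ) (allᶜ-cong λ c → allᶜ-cong λ d →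
  cong₂ _∨_ (cong not (cong₂ _∧_ (S≡ c) (S≡ d))) (cong (_∧ not (c · d)) (S≡ (c ⊕ d))))

module _ {k} {g : Fin k → V} (L : Λ₃⊆⟨ g ⟩⊆½Λ₃) (integral : Integral g) where
  open Λ₃⊆⟨_⟩⊆½Λ₃ L

  classes-orthogonal : ∀ c d → T (classes c) → T (classes d) → c · d ≡ false
  classes-orthogonal c d c∈ d∈ with classes-realized c c∈ | classes-realized d d∈
  ... | w , w∈ , hw | w′ , w′∈ , hw′ = integral⇒orthogonal hw hw′ (integral w w′ w∈ w′∈)

  classes-isotropic-subgroup : T (isotropic-subgroup? classes)
  classes-isotropic-subgroup = Equivalence.from T-∧ (span-0 class , allᶜ-complete λ c → allᶜ-complete λ d → implies λ cd∈ →
    let (c∈ , d∈) = Equivalence.to T-∧ cd∈ in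
    Equivalence.from T-∧ (span-⊕ class c∈ d∈ , subst (T ∘ not) (sym (classes-orthogonal c d c∈ d∈)) tt))

integral⇒Λ₃⊆⟨⟩⊆½Λ₃ : ∀ {k} {g : Fin k → V} → (∀ j → e j ∈⟨ g ⟩) → Integral g → Λ₃⊆⟨ g ⟩⊆½Λ₃
integral⇒Λ₃⊆⟨⟩⊆½Λ₃ {g = g} e∈ integral = record
  { e∈ = e∈ ; class = λ l → classOf (parity ∘ proj₁ (half l)) ; halfInt = λ l → HalfInt-of (proj₁ (half l)) (proj₂ (half l)) }
  where
  half : ∀ l → Σ (Fin 3 → ℤ) λ n → ∀ i → g l i ≡ ½ ℚ.* ι (n i)
  half l = integral-products⇒∈½Λ₃ (g l)
    (λ j → integral (g l) (e j) (∈⟨⟩-generator g l) (e∈ j)) (integral (g l) (g l) (∈⟨⟩-generator g l) (∈⟨⟩-generator g l))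

-- The numerator of 2x; it is exact only when 2x is integral, which the decision below checks.
twice : ∀ {k} → (Fin k → V) → Fin k → Fin 3 → ℤ
twice g l i = ↥ (ι (+ 2) ℚ.* g l i)

Λ₃⊆⟨⟩⊆½Λ₃-by-computation : ∀ {k} (g : Fin k → V) → (∀ j → e j ∈⟨ g ⟩) →
  {True (all? λ l → all? λ i → g l i ℚP.≟ ½ ℚ.* ι (twice g l i))} → Λ₃⊆⟨ g ⟩⊆½Λ₃
Λ₃⊆⟨⟩⊆½Λ₃-by-computation g e∈ {half} = record
  { e∈ = e∈ ; class = λ l → classOf (parity ∘ twice g l) ; halfInt = λ l → HalfInt-of (twice g l) (toWitness half l) }

L₃ : Λ₃⊆⟨ Λ₃ ⟩⊆½Λ₃
L₃ = Λ₃⊆⟨⟩⊆½Λ₃-by-computation Λ₃ (∈⟨⟩-generator Λ₃)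

La : Λ₃⊆⟨ Λa ⟩⊆½Λ₃
La = Λ₃⊆⟨⟩⊆½Λ₃-by-computation Λa (∈⟨⟩-generator Λa ∘ suc)

Lb : Λ₃⊆⟨ Λb ⟩⊆½Λ₃
Lb = Λ₃⊆⟨⟩⊆½Λ₃-by-computation Λb (∈⟨⟩-generator Λb ∘ suc)

Lc : Λ₃⊆⟨ Λc ⟩⊆½Λ₃
Lc = Λ₃⊆⟨⟩⊆½Λ₃-by-computation Λc (∈⟨⟩-generator Λc ∘ suc ∘ suc)

-- σ[c] is an involutive automorphism of Λ₃ acting on classes by c ↦ (1,0,0).
σ[100] σ[010] σ[001] σ[110] σ[011] σ[111] : Involution
σ[100] = involution ((1ℤ ∷ 0ℤ ∷ 0ℤ ∷ []) ∷ (0ℤ ∷ 1ℤ ∷ 0ℤ ∷ []) ∷ (0ℤ ∷ 0ℤ ∷ 1ℤ ∷ []) ∷ [])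
σ[010] = involution ((0ℤ ∷ 1ℤ ∷ -1ℤ ∷ []) ∷ (1ℤ ∷ 0ℤ ∷ -1ℤ ∷ []) ∷ (0ℤ ∷ 0ℤ ∷ -1ℤ ∷ []) ∷ [])
σ[001] = involution ((0ℤ ∷ 0ℤ ∷ 1ℤ ∷ []) ∷ (0ℤ ∷ 1ℤ ∷ 0ℤ ∷ []) ∷ (1ℤ ∷ 0ℤ ∷ 0ℤ ∷ []) ∷ [])
σ[110] = involution ((1ℤ ∷ 0ℤ ∷ 0ℤ ∷ []) ∷ (1ℤ ∷ -1ℤ ∷ 1ℤ ∷ []) ∷ (0ℤ ∷ 0ℤ ∷ 1ℤ ∷ []) ∷ [])
σ[011] = involution ((0ℤ ∷ 0ℤ ∷ 1ℤ ∷ []) ∷ (1ℤ ∷ -1ℤ ∷ 1ℤ ∷ []) ∷ (1ℤ ∷ 0ℤ ∷ 0ℤ ∷ []) ∷ [])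
σ[111] = involution ((1ℤ ∷ 0ℤ ∷ 0ℤ ∷ []) ∷ (1ℤ ∷ 0ℤ ∷ -1ℤ ∷ []) ∷ (1ℤ ∷ -1ℤ ∷ 0ℤ ∷ []) ∷ [])

involutions : List Involution
involutions = σ[100] List.∷ σ[010] List.∷ σ[001] List.∷ σ[110] List.∷ σ[011] List.∷ σ[111] List.∷ List.[]

maps-onto? : Involution → (Class → Bool) → (Class → Bool) → Bool
maps-onto? σ S S′ = allᶜ (λ c → not (S c) ∨ S′ (act M c)) ∧ allᶜ (λ c → not (S′ c) ∨ S (act M c))
  where M = Involution.matrix σ

standardizes? : (Class → Bool) → (Class → Bool) → Bool
standardizes? S S′ = any (λ σ → maps-onto? σ S S′) involutions

Standardizable : (Class → Bool) → (Class → Bool) → Set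
Standardizable S S′ = Σ Involution λ σ → σ maps S into S′ × σ maps S′ into S

standardizes-sound : ∀ S S′ → T (standardizes? S S′) → Standardizable S S′
standardizes-sound S S′ t with Any.satisfied (any⁻ (λ σ → maps-onto? σ S S′) involutions t)
... | σ , onto = σ , forth , back
  where
  M = Involution.matrix σ
  forth : σ maps S into S′
  forth c = modus-ponens (allᶜ-sound (λ c → not (S c) ∨ S′ (act M c)) (proj₁ (Equivalence.to T-∧ onto)) c)
  back : σ maps S′ into S
  back c = modus-ponens (allᶜ-sound (λ c → not (S′ c) ∨ S (act M c)) (proj₂ (Equivalence.to (T-∧ {allᶜ (λ c → not (S c) ∨ S′ (act M c))}) onto)) c)

Standardizable-cong : ∀ {S S′ S″} → (∀ c → S c ≡ S′ c) → Standardizable S S″ → Standardizable S′ S″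
Standardizable-cong S≡ (σ , forth , back) =
  σ , (λ c c∈ → forth c (subst T (sym (S≡ c)) c∈)) , (λ c c∈ → subst T (S≡ _) (back c c∈))

open Λ₃⊆⟨_⟩⊆½Λ₃ using (classes)

standardizes-some? : (Class → Bool) → Bool
standardizes-some? S =
  standardizes? S (classes L₃) ∨ (standardizes? S (classes La) ∨ (standardizes? S (classes Lb) ∨ standardizes? S (classes Lc)))

Standard : (Class → Bool) → Set
Standard S = Standardizable S (classes L₃) ⊎ Standardizable S (classes La) ⊎ Standardizable S (classes Lb) ⊎ Standardizable S (classes Lc)

standardizes-some-sound : ∀ S → T (standardizes-some? S) → Standard S
standardizes-some-sound S t =
  Sum.map (standardizes-sound S (classes L₃)) (λ t′ →
  Sum.map (standardizes-sound S (classes La)) (λ t″ →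
  Sum.map (standardizes-sound S (classes Lb)) (standardizes-sound S (classes Lc))
    (∨-elim {standardizes? S (classes Lb)} {standardizes? S (classes Lc)} t″))
    (∨-elim {standardizes? S (classes La)} {standardizes? S (classes Lb) ∨ standardizes? S (classes Lc)} t′))
    (∨-elim {standardizes? S (classes L₃)} {standardizes? S (classes La) ∨ (standardizes? S (classes Lb) ∨ standardizes? S (classes Lc))} t)

Standard-cong : ∀ {S S′} → (∀ c → S c ≡ S′ c) → Standard S → Standard S′
Standard-cong S≡ (inj₁ s) = inj₁ (Standardizable-cong S≡ s)
Standard-cong S≡ (inj₂ (inj₁ s)) = inj₂ (inj₁ (Standardizable-cong S≡ s))
Standard-cong S≡ (inj₂ (inj₂ (inj₁ s))) = inj₂ (inj₂ (inj₁ (Standardizable-cong S≡ s)))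
Standard-cong S≡ (inj₂ (inj₂ (inj₂ s))) = inj₂ (inj₂ (inj₂ (Standardizable-cong S≡ s)))

classification? : (Class → Bool) → Bool
classification? S = not (isotropic-subgroup? S) ∨ standardizes-some? S

classification-check : T (allVec 8 (classification? ∘ fromTable))
classification-check = tt

classify : ∀ S → T (isotropic-subgroup? S) → Standard S
classify S isotropic = Standard-cong (fromTable-table S) (standardizes-some-sound S′ standard′)
  where
  S′ = fromTable (table S)
  isotropic′ : T (isotropic-subgroup? S′)
  isotropic′ = subst T (sym (isotropic-subgroup?-cong (fromTable-table S))) isotropic
  standard′ : T (standardizes-some? S′)
  standard′ = modus-ponens {isotropic-subgroup? S′} {standardizes-some? S′} (allSubsets-sound {classification?} classification-check S) isotropic′

theorem4p1 : (k : ℕ) (g : Fin k → V) →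
    (∀ j → e j ∈⟨ g ⟩) →
    Integral g →
    Isometric g Λ₃ ⊎ Isometric g Λa ⊎ Isometric g Λb ⊎ Isometric g Λc
theorem4p1 k g e∈ integral =
  Sum.map (isometric-to L₃) (Sum.map (isometric-to La) (Sum.map (isometric-to Lb) (isometric-to Lc)))
    (classify (classes M) (classes-isotropic-subgroup M integral))
  where
  M : Λ₃⊆⟨ g ⟩⊆½Λ₃
  M = integral⇒Λ₃⊆⟨⟩⊆½Λ₃ e∈ integral
  isometric-to : ∀ {m} {h : Fin m → V} (L : Λ₃⊆⟨ h ⟩⊆½Λ₃) → Standardizable (classes M) (classes L) → Isometric g h
  isometric-to L (σ , forth , back) = isometric-via M L σ forth back
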